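{- Let $n\ge 1$ and let $K_n$ be the complete graph on $n$ vertices. For every integer $\ell\ge 0$, \[Z_{(\ell)}(K_n) = \begin{cases} n-1 & \text{if } \ell \le n-2,\\ n & \text{if } \ell \ge n-1.\end{cases}\]
   Context: Let $G=(V,E)$ be a finite simple graph. Color-change rule (zero forcing): given a set of colored vertices, a colored vertex with exactly one uncolored neighbor colors ("forces") that neighbor. Leaks: for a set $L\subseteq V$, placing a leak on each $v\in L$ means attaching to $v$ one new pendant vertex (adjacent only to $v$) which is never initially colored; consequently no vertex of $L$ can ever force a vertex of $V$. A set $S\subseteq V$ is an $\ell$-forcing set if for every $L\subseteq V$ with $|L|\le \ell$, starting with exactly the vertices of $S$ colored and repeatedly applying the color-change rule in the graph with leaks on $L$, every vertex of $V$ eventually becomes colored. $Z_{(\ell)}(G)$ is the minimum size of an $\ell$-forcing set. -}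

module Defs where

open import Data.Nat using (ℕ; _≤_)
open import Data.Fin using (Fin)
open import Data.Fin.Subset using (Subset; _∈_; _∉_; ∣_∣)
open import Data.Product using (Σ; _×_; ∃-syntax)
open import Relation.Binary.PropositionalEquality using (_≡_; _≢_)
open import Relation.Nullary using (¬_)

record Graph (n : ℕ) : Set₁ where
  field
    Adj    : Fin n → Fin n → Set
    sym    : ∀ {u v} → Adj u v → Adj v u
    irrefl : ∀ {u} → ¬ Adj u u

open Graph public

K : (n : ℕ) → Graph n
K n = record
  { Adj    = λ u v → u ≢ v
  ; sym    = λ u≢v v≡u → u≢v (Relation.Binary.PropositionalEquality.sym v≡u)
  ; irrefl = λ u≢u → u≢u Relation.Binary.PropositionalEquality.refl
  }

-- Final colored set of the zero forcing process in G with leaks on L,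
-- starting from the colored set S (vertices of V only; the pendant leak
-- vertices are never initially colored, so a vertex of L always has an
-- uncolored neighbor in V-or-its-pendant and can never force a vertex of V).
data Colored {n : ℕ} (G : Graph n) (L S : Subset n) : Fin n → Set where
  initial : ∀ {v} → v ∈ S → Colored G L S v
  force   : ∀ {u v} → Colored G L S u → u ∉ L → Adj G u v →
            (∀ w → Adj G u w → w ≢ v → Colored G L S w) →
            Colored G L S v

IsLeakyForcingSet : {n : ℕ} → Graph n → ℕ → Subset n → Set
IsLeakyForcingSet {n} G ℓ S =
  ∀ (L : Subset n) → ∣ L ∣ ≤ ℓ → ∀ (v : Fin n) → Colored G L S v

IsZℓ : {n : ℕ} → Graph n → ℕ → ℕ → Set
IsZℓ {n} G ℓ k =
  (∃[ S ] (IsLeakyForcingSet G ℓ S × ∣ S ∣ ≡ k)) ×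
  (∀ (S : Subset n) → IsLeakyForcingSet G ℓ S → k ≤ ∣ S ∣)

-- In K_n every colored vertex is adjacent to every uncolored one, so nothing can be forced while
-- two vertices are uncolored: a forcing set needs at least n − 1 vertices even without leaks.
-- Leaving out a single vertex works exactly when some other vertex escapes the leaks, i.e. when
-- ℓ ≤ n − 2. Once ℓ ≥ n − 1, leaks on all vertices of any set of size below n stall it, so all n
-- vertices are needed (in every graph).
module Submission where

open import Defs
open import Data.Nat using (ℕ; _≤_; _<_; _+_; _∸_; suc; z≤n; s≤s)
open import Data.Nat.Properties using (≤-trans; ≤-pred; +-comm; _≤?_; ≰⇒>)
open import Data.Product using (_×_; _,_; ∃-syntax)
open import Data.Sum using (_⊎_; inj₁; inj₂)
open import Data.Fin using (_≟_) renaming (zero to fzero; suc to fsuc)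
open import Data.Fin.Properties using (suc-injective)
open import Data.Fin.Subset using (Subset; _∈_; _∉_; ∣_∣; ⊤; ⊥; inside; outside)
open import Data.Fin.Subset.Properties using (∈⊤; ∣⊤∣≡n; ∣⊥∣≡0; ∣p∣≤∣x∷p∣)
open import Data.Vec.Base using (_∷_; there)
open import Relation.Binary.PropositionalEquality using (_≢_; refl; subst; ≢-sym) renaming (sym to ≡-sym)
open import Relation.Nullary using (yes; no; contradiction)

∣p∣<n⇒∃∉ : ∀ {n} (p : Subset n) → ∣ p ∣ < n → ∃[ x ] x ∉ p
∣p∣<n⇒∃∉ (outside ∷ p) _         = fzero , λ ()
∣p∣<n⇒∃∉ (inside ∷ p)  (s≤s ∣p∣<n) with ∣p∣<n⇒∃∉ p ∣p∣<n
... | x , x∉p = fsuc x , λ { (there x∈p) → x∉p x∈p }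

2+∣p∣≤n⇒∃₂∉ : ∀ {n} (p : Subset n) → 2 + ∣ p ∣ ≤ n →
  ∃[ x ] ∃[ y ] (x ≢ y × x ∉ p × y ∉ p)
2+∣p∣≤n⇒∃₂∉ (outside ∷ p) (s≤s 1+∣p∣≤n) with ∣p∣<n⇒∃∉ p 1+∣p∣≤n
... | y , y∉p = fzero , fsuc y , (λ ()) , (λ ()) , λ { (there y∈p) → y∉p y∈p }
2+∣p∣≤n⇒∃₂∉ (inside ∷ p)  (s≤s 2+∣p∣≤n) with 2+∣p∣≤n⇒∃₂∉ p 2+∣p∣≤n
... | x , y , x≢y , x∉p , y∉p =
  fsuc x , fsuc y , (λ eq → x≢y (suc-injective eq)) ,
  (λ { (there x∈p) → x∉p x∈p }) , (λ { (there y∈p) → y∉p y∈p })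

Stalled : ∀ {n} → Graph n → (L S : Subset n) → Set
Stalled G L S = ∀ {u} → u ∈ S → u ∈ L ⊎
  ∃[ a ] ∃[ b ] (a ≢ b × Adj G u a × Adj G u b × a ∉ S × b ∉ S)

Colored⇒∈-stalled : ∀ {n} {G : Graph n} {L S} → Stalled G L S →
  ∀ {v} → Colored G L S v → v ∈ S
Colored⇒∈-stalled stalled (initial v∈S) = v∈S
Colored⇒∈-stalled stalled {v} (force u-colored u∉L _ others-colored)
  with stalled (Colored⇒∈-stalled stalled u-colored)
... | inj₁ u∈L = contradiction u∈L u∉L
... | inj₂ (a , b , a≢b , u~a , u~b , a∉S , b∉S) with a ≟ v
...   | yes refl =
  contradiction (Colored⇒∈-stalled stalled (others-colored b u~b (≢-sym a≢b))) b∉S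
...   | no a≢v =
  contradiction (Colored⇒∈-stalled stalled (others-colored a u~a a≢v)) a∉S

leaks-on-S-stalled : ∀ {n} {G : Graph n} {S} → Stalled G S S
leaks-on-S-stalled = inj₁

K-stalled : ∀ {n} {L S : Subset n} {a b} → a ≢ b → a ∉ S → b ∉ S → Stalled (K n) L S
K-stalled {S = S} a≢b a∉S b∉S u∈S =
  inj₂ (_ , _ , a≢b , outside≢ a∉S , outside≢ b∉S , a∉S , b∉S)
  where
  outside≢ : ∀ {x} → x ∉ S → _ ≢ x
  outside≢ x∉S u≡x = x∉S (subst (_∈ S) u≡x u∈S)

⊤-isLeakyForcingSet : ∀ {n} {G : Graph n} {ℓ} → IsLeakyForcingSet G ℓ ⊤
⊤-isLeakyForcingSet L _ v = initial ∈⊤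

K-allButZero-isLeakyForcingSet : ∀ {m ℓ} → ℓ < m →
  IsLeakyForcingSet (K (suc m)) ℓ (outside ∷ ⊤)
K-allButZero-isLeakyForcingSet ℓ<m L           _     (fsuc v) = initial (there ∈⊤)
K-allButZero-isLeakyForcingSet {m} ℓ<m (x ∷ L) ∣x∷L∣≤ℓ fzero
  with ∣p∣<n⇒∃∉ L (≤-trans (s≤s (≤-trans (∣p∣≤∣x∷p∣ x L) ∣x∷L∣≤ℓ)) ℓ<m)
... | u , u∉L = force (initial (there ∈⊤)) (λ { (there u∈L) → u∉L u∈L }) (λ ()) colored
  where
  colored : ∀ w → fsuc u ≢ w → w ≢ fzero → Colored (K (suc m)) (x ∷ L) (outside ∷ ⊤) w
  colored fzero    _ w≢0 = contradiction refl w≢0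
  colored (fsuc w) _ _   = initial (there ∈⊤)

K-leakyForcingSet-size : ∀ {n ℓ} (S : Subset n) → IsLeakyForcingSet (K n) ℓ S →
  n ≤ suc ∣ S ∣
K-leakyForcingSet-size {n} S forcing with n ≤? suc ∣ S ∣
... | yes n≤1+∣S∣ = n≤1+∣S∣
... | no n≰1+∣S∣ with 2+∣p∣≤n⇒∃₂∉ S (≰⇒> n≰1+∣S∣)
...   | a , b , a≢b , a∉S , b∉S =
  contradiction (Colored⇒∈-stalled (K-stalled a≢b a∉S b∉S) (forcing ⊥ no-leaks a)) a∉S
  where
  no-leaks : ∣ ⊥ {n} ∣ ≤ _
  no-leaks = subst (_≤ _) (≡-sym (∣⊥∣≡0 n)) z≤n

leakyForcingSet-size : ∀ {n ℓ} {G : Graph n} → n ≤ suc ℓ →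
  (S : Subset n) → IsLeakyForcingSet G ℓ S → n ≤ ∣ S ∣
leakyForcingSet-size {n} {G = G} n≤1+ℓ S forcing with n ≤? ∣ S ∣
... | yes n≤∣S∣ = n≤∣S∣
... | no n≰∣S∣ with ∣p∣<n⇒∃∉ S (≰⇒> n≰∣S∣)
...   | a , a∉S =
  contradiction (Colored⇒∈-stalled (leaks-on-S-stalled {G = G}) (forcing S ∣S∣≤ℓ a)) a∉S
  where
  ∣S∣≤ℓ : ∣ S ∣ ≤ _
  ∣S∣≤ℓ = ≤-pred (≤-trans (≰⇒> n≰∣S∣) n≤1+ℓ)

proposition13 : ∀ (n : ℕ) → 1 ≤ n → ∀ (ℓ : ℕ) →
    (ℓ + 2 ≤ n → IsZℓ (K n) ℓ (n ∸ 1)) × (n ≤ ℓ + 1 → IsZℓ (K n) ℓ n)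
proposition13 (suc m) _ ℓ = few-leaks , many-leaks
  where
  few-leaks : ℓ + 2 ≤ suc m → IsZℓ (K (suc m)) ℓ m
  few-leaks ℓ+2≤n =
    (outside ∷ ⊤ , K-allButZero-isLeakyForcingSet ℓ<m , ∣⊤∣≡n m) ,
    λ S forcing → ≤-pred (K-leakyForcingSet-size S forcing)
    where
    ℓ<m : ℓ < m
    ℓ<m = ≤-pred (subst (_≤ suc m) (+-comm ℓ 2) ℓ+2≤n)
  many-leaks : suc m ≤ ℓ + 1 → IsZℓ (K (suc m)) ℓ (suc m)
  many-leaks n≤ℓ+1 =
    (⊤ , ⊤-isLeakyForcingSet , ∣⊤∣≡n (suc m)) ,
    leakyForcingSet-size (subst (suc m ≤_) (+-comm ℓ 1) n≤ℓ+1)
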